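{- Let $\eta\in\mathbb{N}^n$ be a nonzero composition with critical row $k$. Then $P[\Phi\eta]=\Phi(P[\eta])$. For $1\le i\le n-1$ with $s_i\eta\ne\eta$ we have $P[s_i\eta]=s_i(P[\eta])$, except in the following two cases: if $i=k-1$ and $\eta_{i+1}-\eta_i>1$ then $P[s_i\eta]=s_i(P[\eta])\cup\{\eta^*\}$; if $i=k$ and $\eta_{i+1}-\eta_i<-1$ then $P[s_i\eta]=s_i(P[\eta])\setminus\{\eta^*\}$.
   Context: For a nonzero composition $\eta\in\mathbb{N}^n$ let $m=\max_i\eta_i$, $k=\min\{i:\eta_i=m\}$ (critical row), and $\eta^*$ the composition obtained by replacing $\eta_k$ with $m-1$. A glissade $\eta\gtrdot\gamma$ means either $\gamma=\eta^*$, or there exist $j\ne k$ and an integer $l>0$ with $\gamma_j=\eta_j+l$, $\gamma_k=m-1-l$, $\gamma_i=\eta_i$ for $i\ne j,k$, where $\varepsilon=m-1-\eta_j-l$ satisfies $\varepsilon>0$ if $j<k$ and $\varepsilon\ge0$ if $j>k$. Define $P[\eta]=\{\gamma:\eta\gtrdot\gamma\}\setminus\{\eta^*\}$. $\Phi\eta=(\eta_2,\dots,\eta_n,\eta_1+1)$; $s_i\eta$ swaps $\eta_i,\eta_{i+1}$; these maps are applied elementwise to sets. -}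

module Defs where

open import Data.Nat using (ℕ; zero; suc; _+_; _∸_; _≤_; _<_)
open import Data.Fin using (Fin; toℕ)
open import Data.Vec using (Vec; []; _∷_; _∷ʳ_; lookup; _[_]≔_)
open import Data.Product using (Σ; ∃; _×_)
open import Data.Sum using (_⊎_)
open import Relation.Binary.PropositionalEquality using (_≡_; _≢_)
open import Relation.Nullary using (¬_)

-- Compositions of length n: vectors of naturals; positions are 0-based Fin n.
Comp : ℕ → Set
Comp n = Vec ℕ n

CSet : ℕ → Set₁
CSet n = Comp n → Set

NonzeroComp : ∀ {n} → Comp n → Set
NonzeroComp {n} η = Σ (Fin n) λ i → lookup η i ≢ 0

IsCritical : ∀ {n} → Comp n → Fin n → Set
IsCritical {n} η k =
  ((i : Fin n) → lookup η i ≤ lookup η k) ×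
  ((i : Fin n) → toℕ i Data.Nat.< toℕ k → lookup η i < lookup η k)

star : ∀ {n} → Comp n → Fin n → Comp n
star η k = η [ k ]≔ (lookup η k ∸ 1)

Slide : ∀ {n} → Comp n → Fin n → Comp n → Set
Slide {n} η k γ =
  Σ (Fin n) λ j → Σ ℕ λ l →
    (j ≢ k) × (0 < l) ×
    (lookup γ j ≡ lookup η j + l) ×
    -- γ_k = m - 1 - l (as a natural number)
    (lookup γ k + l + 1 ≡ lookup η k) ×
    ((i : Fin n) → i ≢ j → i ≢ k → lookup γ i ≡ lookup η i) ×
    -- ε = m - 1 - η_j - l ; ε > 0 if j < k, ε ≥ 0 if j > k
    ((toℕ j < toℕ k → lookup η j + l + 1 < lookup η k) ×
     (toℕ k < toℕ j → lookup η j + l + 1 ≤ lookup η k))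

Glissade : ∀ {n} → Comp n → Comp n → Set
Glissade {n} η γ =
  Σ (Fin n) λ k → IsCritical η k × ((γ ≡ star η k) ⊎ Slide η k γ)

P : ∀ {n} → Comp n → CSet n
P {n} η γ = Glissade η γ × ((k : Fin n) → IsCritical η k → γ ≢ star η k)

Φ : ∀ {n} → Comp n → Comp n
Φ [] = []
Φ (x ∷ xs) = xs ∷ʳ suc x

-- swap positions i and j (used with j = i + 1 for s_i)
swap : ∀ {n} → Comp n → Fin n → Fin n → Comp n
swap η i j = (η [ i ]≔ lookup η j) [ j ]≔ lookup η i

image : ∀ {n} → (Comp n → Comp n) → CSet n → CSet n
image {n} f S γ = Σ (Comp n) λ δ → S δ × (f δ ≡ γ)

_∪_ : ∀ {n} → CSet n → CSet n → CSet n
(S ∪ T) γ = S γ ⊎ T γ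

_∖_ : ∀ {n} → CSet n → CSet n → CSet n
(S ∖ T) γ = S γ × ¬ T γ

singleton : ∀ {n} → Comp n → CSet n
singleton a γ = γ ≡ a

_≐_ : ∀ {n} → CSet n → CSet n → Set
S ≐ T = ∀ γ → (S γ → T γ) × (T γ → S γ)

-- A glissade in P[η] moves l > 0 cells from the critical row k to a row j ≠ k, and it is allowed iff
-- η_j + l + 1 + [j < k] ≤ η_k (this is ε ≥ [j < k]). Both Φ and s_i permute positions, Φ also adding 1
-- to the entry it carries from the first to the last position. They carry the critical row of η to that
-- of the image and moves to moves, so only the Iverson bracket [j < k] needs attention. For Φ the added
-- unit compensates exactly for the change of the bracket. For s_i the bracket changes only on the pair of
-- rows i, i + 1, and the one move that breaks is the move from row i onto row i + 1 with ε = 0; it exists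
-- iff k = i and η_{i+1} + 1 < η_i, and s_i carries it to η* itself, which lies outside P[s_i η]. Applying
-- the same to s_i η shows that η* is gained instead when k = i + 1 and η_i + 1 < η_{i+1}.
module Submission where

open import Defs
open import Data.Fin using (Fin; zero; suc; toℕ; fromℕ; inject₁)
open import Data.Fin.Permutation
  using (Permutation′; permutation; _⟨$⟩ʳ_; _⟨$⟩ˡ_; inverseˡ; inverseʳ)
  renaming (transpose to transposition)
open import Data.Fin.Permutation.Components using (transpose)
open import Data.Fin.Properties
  using (toℕ-injective; toℕ-fromℕ; toℕ-inject₁; toℕ<n; toℕ≤pred[n]) renaming (_≟_ to _≟ᶠ_)
open import Data.Fin.Relation.Unary.Top using (view; ‵fromℕ; ‵inject₁; view-fromℕ; view-inject₁)
open import Data.Nat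
  using (ℕ; zero; suc; pred; _+_; _∸_; _≤_; _<_; z≤n; s≤s; z<s; _<?_; >-nonZero)
  renaming (_≟_ to _≟ℕ_)
open import Data.Nat.Properties
open import Data.Nat.Tactic.RingSolver using (solve-∀)
open import Algebra.Properties.CommutativeSemigroup +-commutativeSemigroup using (xy∙z≈xz∙y)
open import Data.Product using (Σ; ∃; _×_; _,_; proj₁; proj₂)
open import Data.Sum using (inj₁; inj₂)
open import Data.Vec using (Vec; []; _∷_; _∷ʳ_; lookup; initLast; _[_]≔_)
open import Data.Vec.Properties using (lookup∘update; lookup∘update′; ≡-dec)
open import Data.Vec.Relation.Binary.Pointwise.Extensional using (ext; Pointwise-≡⇒≡)
open import Function using (_∘_; _⇔_; mk⇔; Equivalence)
open import Relation.Binary using (tri<; tri≈; tri>)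
open import Relation.Binary.PropositionalEquality
open import Relation.Nullary using (¬_; yes; no; contradiction)
open import Relation.Nullary.Decidable using (dec-true; dec-false; _×-dec_)

open Equivalence using (to; from)

private
  variable
    n l c : ℕ
    η η′ γ δ : Comp n
    i j k k′ : Fin n

⟦_<_⟧ : ℕ → ℕ → ℕ
⟦ _     < zero  ⟧ = 0
⟦ zero  < suc _ ⟧ = 1
⟦ suc m < suc n ⟧ = ⟦ m < n ⟧

⟦<⟧≡1 : ∀ {m n} → m < n → ⟦ m < n ⟧ ≡ 1
⟦<⟧≡1 {zero}  {suc n} _         = refl
⟦<⟧≡1 {suc m} {suc n} (s≤s m<n) = ⟦<⟧≡1 m<n

⟦<⟧≡0 : ∀ {m n} → n ≤ m → ⟦ m < n ⟧ ≡ 0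
⟦<⟧≡0 {m}     {zero}  _         = refl
⟦<⟧≡0 {suc m} {suc n} (s≤s n≤m) = ⟦<⟧≡0 n≤m

⟦<⟧-mono : ∀ {m n m′ n′} → (m′ < n′ → m < n) → ⟦ m′ < n′ ⟧ ≤ ⟦ m < n ⟧
⟦<⟧-mono {m′ = m′} {n′} f with m′ <? n′
... | yes lt rewrite ⟦<⟧≡1 lt | ⟦<⟧≡1 (f lt) = ≤-refl
... | no ¬lt rewrite ⟦<⟧≡0 (≮⇒≥ ¬lt) = z≤n

m+n+1≡1+n+m : ∀ m n → m + n + 1 ≡ suc n + m
m+n+1≡1+n+m = solve-∀

m+1<n⇒1+m<n : ∀ {m n} → m + 1 < n → suc m < n
m+1<n⇒1+m<n {m} {n} = subst (_< n) (+-comm m 1)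

vec-ext : ∀ {xs ys : Vec ℕ n} → (∀ i → lookup xs i ≡ lookup ys i) → xs ≡ ys
vec-ext eq = Pointwise-≡⇒≡ (ext eq)

lookup-∷ʳ-fromℕ : ∀ (xs : Vec ℕ n) y → lookup (xs ∷ʳ y) (fromℕ n) ≡ y
lookup-∷ʳ-fromℕ []       y = refl
lookup-∷ʳ-fromℕ (x ∷ xs) y = lookup-∷ʳ-fromℕ xs y

lookup-∷ʳ-inject₁ : ∀ (xs : Vec ℕ n) y i → lookup (xs ∷ʳ y) (inject₁ i) ≡ lookup xs i
lookup-∷ʳ-inject₁ (x ∷ xs) y zero    = refl
lookup-∷ʳ-inject₁ (x ∷ xs) y (suc i) = lookup-∷ʳ-inject₁ xs y i

lookup-star : ∀ (η : Comp n) k → lookup (star η k) k ≡ lookup η k ∸ 1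
lookup-star η k = lookup∘update k η _

lookup-star-≢ : ∀ (η : Comp n) k {i} → i ≢ k → lookup (star η k) i ≡ lookup η i
lookup-star-≢ η k i≢k = lookup∘update′ i≢k η _

-- Glissades from the critical row

Headroom : Comp n → Fin n → Fin n → ℕ → Set
Headroom η k i c = ⟦ toℕ i < toℕ k ⟧ + (c + lookup η i) ≤ lookup η k

IsCritical⇔ : IsCritical η k ⇔ (∀ i → i ≢ k → Headroom η k i 0)
IsCritical⇔ {η = η} {k = k} = mk⇔ forth back
  where
  forth : IsCritical η k → ∀ i → i ≢ k → Headroom η k i 0
  forth (maximal , leftmost) i i≢k with <-cmp (toℕ i) (toℕ k)
  ... | tri< i<k _ _ rewrite ⟦<⟧≡1 i<k = leftmost i i<k
  ... | tri≈ _ i≡k _ = contradiction (toℕ-injective i≡k) i≢k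
  ... | tri> _ _ k<i rewrite ⟦<⟧≡0 (<⇒≤ k<i) = maximal i
  back : (∀ i → i ≢ k → Headroom η k i 0) → IsCritical η k
  back headroom = maximal , leftmost
    where
    maximal : ∀ i → lookup η i ≤ lookup η k
    maximal i with i ≟ᶠ k
    ... | yes refl = ≤-refl
    ... | no i≢k = ≤-trans (m≤n+m _ _) (headroom i i≢k)
    leftmost : ∀ i → toℕ i < toℕ k → lookup η i < lookup η k
    leftmost i i<k = subst (_≤ lookup η k) (cong (_+ lookup η i) (⟦<⟧≡1 i<k))
                       (headroom i λ { refl → <-irrefl refl i<k })

IsCritical-unique : IsCritical η k → IsCritical η k′ → k ≡ k′
IsCritical-unique {k = k} {k′ = k′} (maximal , leftmost) (maximal′ , leftmost′)
  with <-cmp (toℕ k) (toℕ k′)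
... | tri< k<k′ _ _ = contradiction (leftmost′ k k<k′) (≤⇒≯ (maximal k′))
... | tri≈ _ k≡k′ _ = toℕ-injective k≡k′
... | tri> _ _ k′<k = contradiction (leftmost k′ k′<k) (≤⇒≯ (maximal′ k))

Room : Comp n → Fin n → Fin n → ℕ → Set
Room η k j l = (toℕ j < toℕ k → lookup η j + l + 1 < lookup η k) ×
               (toℕ k < toℕ j → lookup η j + l + 1 ≤ lookup η k)

Room⇔Headroom : j ≢ k → Room η k j l ⇔ Headroom η k j (suc l)
Room⇔Headroom {j = j} {k = k} {η = η} {l = l} j≢k
  rewrite +-comm (lookup η j + l) 1 | +-comm (lookup η j) l
  with <-cmp (toℕ j) (toℕ k)
... | tri< j<k _ k≮j rewrite ⟦<⟧≡1 j<k =
  mk⇔ (λ room → proj₁ room j<k) (λ h → (λ _ → h) , λ k<j → contradiction k<j k≮j)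
... | tri≈ _ j≡k _ = contradiction (toℕ-injective j≡k) j≢k
... | tri> j≮k _ k<j rewrite ⟦<⟧≡0 (<⇒≤ k<j) =
  mk⇔ (λ room → proj₂ room k<j) (λ h → (λ j<k → contradiction j<k j≮k) , λ _ → h)

record Move (η : Comp n) (k : Fin n) (γ : Comp n) (j : Fin n) (l : ℕ) : Set where
  field
    j≢k       : j ≢ k
    0<l       : 0 < l
    at-j      : lookup γ j ≡ lookup η j + l
    at-k      : lookup γ k + l + 1 ≡ lookup η k
    elsewhere : ∀ i → i ≢ j → i ≢ k → lookup γ i ≡ lookup η i

record Glide (η : Comp n) (k : Fin n) (γ : Comp n) : Set where
  constructor glide
  field
    {target} : Fin n
    {amount} : ℕ
    move     : Move η k γ target amount
    headroom : Headroom η k target (suc amount)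

Slide⇔Glide : Slide η k γ ⇔ Glide η k γ
Slide⇔Glide {η = η} = mk⇔
  (λ { (j , l , j≢k , 0<l , at-j , at-k , elsewhere , room) →
         glide (record { j≢k = j≢k ; 0<l = 0<l ; at-j = at-j ; at-k = at-k ; elsewhere = elsewhere })
               (to (Room⇔Headroom {η = η} {l = l} j≢k) room) })
  (λ { (glide {j} {l} m h) → let open Move m in
         j , l , j≢k , 0<l , at-j , at-k , elsewhere , from (Room⇔Headroom {η = η} {l = l} j≢k) h })

Glide⇒≢star : Glide η k γ → γ ≢ star η k
Glide⇒≢star {η = η} {k = k} (glide {j} m _) refl =
  <-irrefl (trans (sym (lookup-star-≢ η k j≢k)) at-j) (m<m+n (lookup η j) 0<l)
  where open Move m

P⇔Glide : IsCritical η k → P η γ ⇔ Glide η k γ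
P⇔Glide {η = η} {k = k} {γ = γ} crit = mk⇔
  (λ { ((k′ , crit′ , inj₁ γ≡star) , ≢star) → contradiction γ≡star (≢star k′ crit′)
     ; ((k′ , crit′ , inj₂ s) , _) →
         to Slide⇔Glide (subst (λ k → Slide η k γ) (IsCritical-unique {η = η} crit′ crit) s) })
  (λ g → (k , crit , inj₂ (from Slide⇔Glide g)) ,
         λ k′ crit′ → subst (λ k → γ ≢ star η k) (IsCritical-unique {η = η} crit crit′) (Glide⇒≢star g))

-- Relabelling positions

module _ (π : Permutation′ n) (d : Fin n → ℕ) {η η′ γ γ′ : Comp n}
         (η′∘π : ∀ x → lookup η′ (π ⟨$⟩ʳ x) ≡ lookup η x + d x)
         (γ′∘π : ∀ x → lookup γ′ (π ⟨$⟩ʳ x) ≡ lookup γ x + d x) where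

  Move-transport : Move η k γ j l ⇔ Move η′ (π ⟨$⟩ʳ k) γ′ (π ⟨$⟩ʳ j) l
  Move-transport {k = k} {j = j} {l = l} = mk⇔ forth back
    where
    open ≡-Reasoning
    π-injective : ∀ {x y} → π ⟨$⟩ʳ x ≡ π ⟨$⟩ʳ y → x ≡ y
    π-injective eq = trans (sym (inverseˡ π)) (trans (cong (π ⟨$⟩ˡ_) eq) (inverseˡ π))
    shift : ∀ x d l → x + d + l + 1 ≡ x + l + 1 + d
    shift = solve-∀
    forth : Move η k γ j l → Move η′ (π ⟨$⟩ʳ k) γ′ (π ⟨$⟩ʳ j) l
    forth m = record
      { j≢k = j≢k ∘ π-injective
      ; 0<l = 0<l
      ; at-j = begin
          lookup γ′ (π ⟨$⟩ʳ j)      ≡⟨ γ′∘π j ⟩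
          lookup γ j + d j          ≡⟨ cong (_+ d j) at-j ⟩
          lookup η j + l + d j      ≡⟨ xy∙z≈xz∙y _ l (d j) ⟩
          lookup η j + d j + l      ≡⟨ cong (_+ l) (η′∘π j) ⟨
          lookup η′ (π ⟨$⟩ʳ j) + l  ∎
      ; at-k = begin
          lookup γ′ (π ⟨$⟩ʳ k) + l + 1  ≡⟨ cong (λ z → z + l + 1) (γ′∘π k) ⟩
          lookup γ k + d k + l + 1      ≡⟨ shift _ (d k) l ⟩
          lookup γ k + l + 1 + d k      ≡⟨ cong (_+ d k) at-k ⟩
          lookup η k + d k              ≡⟨ η′∘π k ⟨
          lookup η′ (π ⟨$⟩ʳ k)          ∎
      ; elsewhere = λ i i≢πj i≢πk →
          let x = π ⟨$⟩ˡ i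
              ≢π⁻¹ : ∀ {y} → i ≢ π ⟨$⟩ʳ y → x ≢ y
              ≢π⁻¹ i≢πy x≡y = i≢πy (trans (sym (inverseʳ π)) (cong (π ⟨$⟩ʳ_) x≡y))
          in subst (λ i → lookup γ′ i ≡ lookup η′ i) (inverseʳ π) (begin
            lookup γ′ (π ⟨$⟩ʳ x)  ≡⟨ γ′∘π x ⟩
            lookup γ x + d x      ≡⟨ cong (_+ d x) (elsewhere x (≢π⁻¹ i≢πj) (≢π⁻¹ i≢πk)) ⟩
            lookup η x + d x      ≡⟨ η′∘π x ⟨
            lookup η′ (π ⟨$⟩ʳ x)  ∎)
      }
      where open Move m
    back : Move η′ (π ⟨$⟩ʳ k) γ′ (π ⟨$⟩ʳ j) l → Move η k γ j l
    back m = record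
      { j≢k = j≢k ∘ cong (π ⟨$⟩ʳ_)
      ; 0<l = 0<l
      ; at-j = +-cancelʳ-≡ (d j) _ _ (begin
          lookup γ j + d j          ≡⟨ γ′∘π j ⟨
          lookup γ′ (π ⟨$⟩ʳ j)      ≡⟨ at-j ⟩
          lookup η′ (π ⟨$⟩ʳ j) + l  ≡⟨ cong (_+ l) (η′∘π j) ⟩
          lookup η j + d j + l      ≡⟨ xy∙z≈xz∙y _ (d j) l ⟩
          lookup η j + l + d j      ∎)
      ; at-k = +-cancelʳ-≡ (d k) _ _ (begin
          lookup γ k + l + 1 + d k      ≡⟨ shift _ (d k) l ⟨
          lookup γ k + d k + l + 1      ≡⟨ cong (λ z → z + l + 1) (γ′∘π k) ⟨
          lookup γ′ (π ⟨$⟩ʳ k) + l + 1  ≡⟨ at-k ⟩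
          lookup η′ (π ⟨$⟩ʳ k)          ≡⟨ η′∘π k ⟩
          lookup η k + d k              ∎)
      ; elsewhere = λ i i≢j i≢k → +-cancelʳ-≡ (d i) _ _ (begin
          lookup γ i + d i      ≡⟨ γ′∘π i ⟨
          lookup γ′ (π ⟨$⟩ʳ i)  ≡⟨ elsewhere (π ⟨$⟩ʳ i) (i≢j ∘ π-injective) (i≢k ∘ π-injective) ⟩
          lookup η′ (π ⟨$⟩ʳ i)  ≡⟨ η′∘π i ⟩
          lookup η i + d i      ∎)
      }
      where open Move m

IsCritical-transport : (π : Permutation′ n) →
  (∀ i → i ≢ k → Headroom η k i 0 → Headroom η′ (π ⟨$⟩ʳ k) (π ⟨$⟩ʳ i) 0) →
  IsCritical η k → IsCritical η′ (π ⟨$⟩ʳ k)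
IsCritical-transport {k = k} {η = η} {η′ = η′} π transfer crit =
  from (IsCritical⇔ {η = η′}) λ i i≢πk →
    let π⁻¹i≢k = λ eq → i≢πk (trans (sym (inverseʳ π)) (cong (π ⟨$⟩ʳ_) eq))
    in subst (λ i → Headroom η′ (π ⟨$⟩ʳ k) i 0) (inverseʳ π)
         (transfer _ π⁻¹i≢k (to (IsCritical⇔ {η = η}) crit _ π⁻¹i≢k))

-- Promotion

rotate : Fin (suc n) → Fin (suc n)
rotate {n} zero = fromℕ n
rotate (suc i)  = inject₁ i

rotate⁻¹ : Fin (suc n) → Fin (suc n)
rotate⁻¹ i with view i
... | ‵fromℕ     = zero
... | ‵inject₁ j = suc j

rotate∘rotate⁻¹ : ∀ (i : Fin (suc n)) → rotate (rotate⁻¹ i) ≡ i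
rotate∘rotate⁻¹ i with view i
... | ‵fromℕ     = refl
... | ‵inject₁ j = refl

rotate⁻¹∘rotate : ∀ (i : Fin (suc n)) → rotate⁻¹ (rotate i) ≡ i
rotate⁻¹∘rotate {n} zero rewrite view-fromℕ n = refl
rotate⁻¹∘rotate (suc i) rewrite view-inject₁ i = refl

rotation : Permutation′ (suc n)
rotation = permutation rotate rotate⁻¹ rotate∘rotate⁻¹ rotate⁻¹∘rotate

bump : Fin (suc n) → ℕ
bump zero    = 1
bump (suc _) = 0

lookup-Φ : ∀ (η : Comp (suc n)) i → lookup (Φ η) (rotate i) ≡ lookup η i + bump i
lookup-Φ (x ∷ xs) zero    = trans (lookup-∷ʳ-fromℕ xs (suc x)) (+-comm 1 x)
lookup-Φ (x ∷ xs) (suc i) = trans (lookup-∷ʳ-inject₁ xs (suc x) i) (sym (+-identityʳ _))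

⟦rotate<rotate⟧ : {i k : Fin (suc n)} → i ≢ k →
  bump i + ⟦ toℕ (rotate i) < toℕ (rotate k) ⟧ ≡ ⟦ toℕ i < toℕ k ⟧ + bump k
⟦rotate<rotate⟧ {i = zero} {zero} i≢k = contradiction refl i≢k
⟦rotate<rotate⟧ {n} {zero} {suc k} _
  rewrite toℕ-fromℕ n | toℕ-inject₁ k | ⟦<⟧≡0 (<⇒≤ (toℕ<n k)) = refl
⟦rotate<rotate⟧ {n} {suc i} {zero} _
  rewrite toℕ-fromℕ n | toℕ-inject₁ i | ⟦<⟧≡1 (toℕ<n i) = refl
⟦rotate<rotate⟧ {i = suc i} {suc k} _
  rewrite toℕ-inject₁ i | toℕ-inject₁ k = sym (+-identityʳ _)

Headroom-Φ : {η : Comp (suc n)} → i ≢ k →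
  Headroom η k i c ⇔ Headroom (Φ η) (rotate k) (rotate i) c
Headroom-Φ {i = i} {k = k} {c = c} {η = η} i≢k = mk⇔
  (λ h → subst₂ _≤_ (sym regroup) (sym (lookup-Φ η k)) (+-monoˡ-≤ (bump k) h))
  (λ h → +-cancelʳ-≤ (bump k) _ _ (subst₂ _≤_ regroup (lookup-Φ η k) h))
  where
  open ≡-Reasoning
  b = ⟦ toℕ i < toℕ k ⟧
  b′ = ⟦ toℕ (rotate i) < toℕ (rotate k) ⟧
  e = lookup η i
  reorder : ∀ b′ c e d → b′ + (c + (e + d)) ≡ d + b′ + (c + e)
  reorder = solve-∀
  regroup : b′ + (c + lookup (Φ η) (rotate i)) ≡ b + (c + e) + bump k
  regroup = begin
    b′ + (c + lookup (Φ η) (rotate i))  ≡⟨ cong (λ x → b′ + (c + x)) (lookup-Φ η i) ⟩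
    b′ + (c + (e + bump i))             ≡⟨ reorder b′ c e (bump i) ⟩
    bump i + b′ + (c + e)               ≡⟨ cong (_+ (c + e)) (⟦rotate<rotate⟧ i≢k) ⟩
    b + bump k + (c + e)                ≡⟨ xy∙z≈xz∙y b (bump k) (c + e) ⟩
    b + (c + e) + bump k                ∎

IsCritical-Φ : {η : Comp (suc n)} → IsCritical η k → IsCritical (Φ η) (rotate k)
IsCritical-Φ {η = η} =
  IsCritical-transport {η = η} {η′ = Φ η} rotation (λ _ i≢k → to (Headroom-Φ {c = 0} {η = η} i≢k))

Glide-Φ : {η δ : Comp (suc n)} → Glide η k δ ⇔ Glide (Φ η) (rotate k) (Φ δ)
Glide-Φ {k = k} {η = η} {δ = δ} = mk⇔
  (λ { (glide m h) → glide (to transport m) (to (Headroom-Φ {η = η} (Move.j≢k m)) h) })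
  back
  where
  transport : ∀ {j l} → Move η k δ j l ⇔ Move (Φ η) (rotate k) (Φ δ) (rotate j) l
  transport = Move-transport rotation bump (lookup-Φ η) (lookup-Φ δ)
  back : Glide (Φ η) (rotate k) (Φ δ) → Glide η k δ
  back (glide {j′} m h) with rotate⁻¹ j′ | rotate∘rotate⁻¹ j′
  ... | j | refl = let m′ = from (transport {j = j}) m in
    glide m′ (from (Headroom-Φ {η = η} (Move.j≢k m′)) h)

Glide-last-positive : {η γ : Comp (suc n)} → Glide η k γ →
  0 < lookup η (fromℕ n) → 0 < lookup γ (fromℕ n)
Glide-last-positive {n} {k} {η} {γ} (glide {j} {l} m h) pos
  with fromℕ n ≟ᶠ j | fromℕ n ≟ᶠ k
... | yes refl | _ = subst (0 <_) (sym at-j) (≤-trans 0<l (m≤n+m l _))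
  where open Move m
... | no last≢j | no last≢k = subst (0 <_) (sym (elsewhere _ last≢j last≢k)) pos
  where open Move m
... | no last≢j | yes refl =
  -- the last row lies below j, so ε ≥ 1 and γ_k = η_j + ε is positive
  remainder-positive (subst (λ b → b + (suc l + lookup η j) ≤ lookup η k) j<last h) at-k
  where
  open Move m
  j<last : ⟦ toℕ j < toℕ (fromℕ n) ⟧ ≡ 1
  j<last = ⟦<⟧≡1 (≤∧≢⇒< (subst (toℕ j ≤_) (sym (toℕ-fromℕ n)) (toℕ≤pred[n] j))
                         (last≢j ∘ sym ∘ toℕ-injective))
  remainder-positive : ∀ {g x y} → suc (suc l + x) ≤ y → g + l + 1 ≡ y → 0 < g
  remainder-positive {zero} {x} h refl =
    contradiction h (<⇒≱ (s≤s (subst (_≤ suc (l + x)) (+-comm 1 l) (s≤s (m≤m+n l x)))))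
  remainder-positive {suc g} _ _ = z<s

Φ-last-positive : ∀ (η : Comp (suc n)) → 0 < lookup (Φ η) (fromℕ n)
Φ-last-positive (x ∷ xs) = subst (0 <_) (sym (lookup-∷ʳ-fromℕ xs (suc x))) z<s

Φ-preimage : ∀ (γ : Comp (suc n)) → 0 < lookup γ (fromℕ n) → ∃ λ δ → Φ δ ≡ γ
Φ-preimage γ pos with ys , y , refl ← initLast γ =
  pred y ∷ ys , cong (ys ∷ʳ_) (suc-pred y {{>-nonZero (subst (0 <_) (lookup-∷ʳ-fromℕ ys y) pos)}})

P-Φ : IsCritical η k → P (Φ η) ≐ image Φ (P η)
P-Φ {zero} {k = ()}
P-Φ {suc n} {η} {k} crit γ = ⊆ , ⊇
  where
  critΦ = IsCritical-Φ {η = η} crit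
  ⊆ : P (Φ η) γ → image Φ (P η) γ
  ⊆ p with g ← to (P⇔Glide critΦ) p
      with δ , refl ← Φ-preimage γ (Glide-last-positive g (Φ-last-positive η)) =
    δ , from (P⇔Glide crit) (from Glide-Φ g) , refl
  ⊇ : image Φ (P η) γ → P (Φ η) γ
  ⊇ (δ , p , refl) = from (P⇔Glide critΦ) (to Glide-Φ (to (P⇔Glide crit) p))

-- Adjacent transpositions

module _ {a b : Fin n} (adjacent : toℕ b ≡ suc (toℕ a)) where

  private
    a<b : toℕ a < toℕ b
    a<b = ≤-reflexive (sym adjacent)

    a≢b : a ≢ b
    a≢b a≡b = <-irrefl (cong toℕ a≡b) a<b

  τ : Fin n → Fin n
  τ = transpose a b

  τa≡b : τ a ≡ b
  τa≡b rewrite dec-true (a ≟ᶠ a) refl = refl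

  τb≡a : τ b ≡ a
  τb≡a rewrite dec-false (b ≟ᶠ a) (a≢b ∘ sym) | dec-true (b ≟ᶠ b) refl = refl

  τ-fix : ∀ {x} → x ≢ a → x ≢ b → τ x ≡ x
  τ-fix {x} x≢a x≢b rewrite dec-false (x ≟ᶠ a) x≢a | dec-false (x ≟ᶠ b) x≢b = refl

  data Place (x : Fin n) : Set where
    at-a  : x ≡ a → Place x
    at-b  : x ≡ b → Place x
    apart : x ≢ a → x ≢ b → Place x

  place : ∀ x → Place x
  place x with x ≟ᶠ a | x ≟ᶠ b
  ... | yes x≡a | _       = at-a x≡a
  ... | no _    | yes x≡b = at-b x≡b
  ... | no x≢a  | no x≢b  = apart x≢a x≢b

  τ-involutive : ∀ x → τ (τ x) ≡ x
  τ-involutive x with place x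
  ... | at-a refl     = trans (cong τ τa≡b) τb≡a
  ... | at-b refl     = trans (cong τ τb≡a) τa≡b
  ... | apart x≢a x≢b = trans (cong τ (τ-fix x≢a x≢b)) (τ-fix x≢a x≢b)

  τ-reflects-< : ∀ x y → ¬ (x ≡ b × y ≡ a) → toℕ (τ x) < toℕ (τ y) → toℕ x < toℕ y
  τ-reflects-< x y ¬ba lt with place x | place y
  ... | at-a refl | at-a refl = contradiction lt (<-irrefl refl)
  ... | at-a refl | at-b refl = a<b
  ... | at-a refl | apart y≢a y≢b =
    <-trans a<b (subst₂ _<_ (cong toℕ τa≡b) (cong toℕ (τ-fix y≢a y≢b)) lt)
  ... | at-b refl | at-a refl = contradiction (refl , refl) ¬ba
  ... | at-b refl | at-b refl = contradiction lt (<-irrefl refl)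
  ... | at-b refl | apart y≢a y≢b =
    ≤∧≢⇒< (subst (_≤ toℕ y) (sym adjacent) (subst₂ _<_ (cong toℕ τb≡a) (cong toℕ (τ-fix y≢a y≢b)) lt))
          (y≢b ∘ sym ∘ toℕ-injective)
  ... | apart x≢a x≢b | at-a refl =
    ≤∧≢⇒< (≤-pred (subst (toℕ x <_) adjacent (subst₂ _<_ (cong toℕ (τ-fix x≢a x≢b)) (cong toℕ τa≡b) lt)))
          (x≢a ∘ toℕ-injective)
  ... | apart x≢a x≢b | at-b refl =
    <-trans (subst₂ _<_ (cong toℕ (τ-fix x≢a x≢b)) (cong toℕ τb≡a) lt) a<b
  ... | apart x≢a x≢b | apart y≢a y≢b =
    subst₂ _<_ (cong toℕ (τ-fix x≢a x≢b)) (cong toℕ (τ-fix y≢a y≢b)) lt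

  lookup-swap : ∀ (η : Comp n) x → lookup (swap η a b) x ≡ lookup η (τ x)
  lookup-swap η x with place x
  ... | at-a refl = trans (lookup∘update′ a≢b (η [ a ]≔ lookup η b) (lookup η a))
                      (trans (lookup∘update a η (lookup η b)) (cong (lookup η) (sym τa≡b)))
  ... | at-b refl = trans (lookup∘update b (η [ a ]≔ lookup η b) (lookup η a)) (cong (lookup η) (sym τb≡a))
  ... | apart x≢a x≢b =
    trans (lookup∘update′ x≢b (η [ a ]≔ lookup η b) (lookup η a))
      (trans (lookup∘update′ x≢a η (lookup η b)) (cong (lookup η) (sym (τ-fix x≢a x≢b))))

  lookup-swap-τ : ∀ (η : Comp n) x → lookup (swap η a b) (τ x) ≡ lookup η x
  lookup-swap-τ η x = trans (lookup-swap η (τ x)) (cong (lookup η) (τ-involutive x))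

  lookup-swap-a : ∀ (η : Comp n) → lookup (swap η a b) a ≡ lookup η b
  lookup-swap-a η = trans (lookup-swap η a) (cong (lookup η) τa≡b)

  lookup-swap-b : ∀ (η : Comp n) → lookup (swap η a b) b ≡ lookup η a
  lookup-swap-b η = trans (lookup-swap η b) (cong (lookup η) τb≡a)

  swap-involutive : ∀ (η : Comp n) → swap (swap η a b) a b ≡ η
  swap-involutive η = vec-ext λ x → trans (lookup-swap (swap η a b) x) (lookup-swap-τ η x)

  swap-trivial : ∀ (η : Comp n) → lookup η a ≡ lookup η b → swap η a b ≡ η
  swap-trivial η ηa≡ηb = vec-ext λ x → trans (lookup-swap η x) (fixed x)
    where
    fixed : ∀ x → lookup η (τ x) ≡ lookup η x
    fixed x with place x
    ... | at-a refl     = trans (cong (lookup η) τa≡b) (sym ηa≡ηb)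
    ... | at-b refl     = trans (cong (lookup η) τb≡a) ηa≡ηb
    ... | apart x≢a x≢b = cong (lookup η) (τ-fix x≢a x≢b)

  swap-star : ∀ (η : Comp n) x → swap (star η x) a b ≡ star (swap η a b) (τ x)
  swap-star η x = vec-ext λ y → trans (lookup-swap (star η x) y) (pointwise y)
    where
    pointwise : ∀ y → lookup (star η x) (τ y) ≡ lookup (star (swap η a b) (τ x)) y
    pointwise y with τ y ≟ᶠ x
    ... | yes refl rewrite τ-involutive y =
      trans (lookup-star η (τ y))
        (trans (cong (_∸ 1) (sym (lookup-swap η y))) (sym (lookup-star (swap η a b) y)))
    ... | no τy≢x =
      trans (lookup-star-≢ η x τy≢x)
        (trans (sym (lookup-swap η y))
          (sym (lookup-star-≢ (swap η a b) (τ x) λ y≡τx → τy≢x (trans (cong τ y≡τx) (τ-involutive x)))))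

  swap-star-swap : ∀ (η : Comp n) x → swap (star (swap η a b) (τ x)) a b ≡ star η x
  swap-star-swap η x =
    trans (swap-star (swap η a b) (τ x)) (cong₂ star (swap-involutive η) (τ-involutive x))

  Headroom-swap : Headroom η k i c → (i ≡ b → k ≡ a → c + lookup η i ≢ lookup η k) →
    Headroom (swap η a b) (τ k) (τ i) c
  Headroom-swap {η = η} {k = k} {i = i} {c = c} h not-tight
    rewrite lookup-swap-τ η i | lookup-swap-τ η k with (i ≟ᶠ b) ×-dec (k ≟ᶠ a)
  ... | yes (refl , refl) rewrite τa≡b | τb≡a | ⟦<⟧≡1 a<b | ⟦<⟧≡0 (<⇒≤ a<b) =
    ≤∧≢⇒< h (not-tight refl refl)
  ... | no ¬ba = ≤-trans (+-monoˡ-≤ _ (⟦<⟧-mono (τ-reflects-< i k ¬ba))) h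

  IsCritical-swap : IsCritical η k → swap η a b ≢ η → IsCritical (swap η a b) (τ k)
  IsCritical-swap {η = η} crit nontrivial =
    IsCritical-transport {η = η} {η′ = swap η a b} (transposition a b)
      (λ _ _ h → Headroom-swap {η = η} h λ { refl refl ηb≡ηa → nontrivial (swap-trivial η (sym ηb≡ηa)) })
      crit

  -- The move from row a onto row b leaving ε = 0: the one move that swapping a and b does not preserve.
  Tight : Comp n → Fin n → Comp n → Set
  Tight η k δ = k ≡ a × Σ ℕ λ l → Move η k δ b l × suc l + lookup η b ≡ lookup η k

  Glide-swap : Glide η k δ → ¬ Tight η k δ → Glide (swap η a b) (τ k) (swap δ a b)
  Glide-swap {η = η} {δ = δ} (glide {j} {l} m h) ¬tight =
    glide (to (Move-transport (transposition a b) (λ _ → 0) (relabel η) (relabel δ)) m)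
          (Headroom-swap {η = η} h λ { refl refl eq → ¬tight (refl , l , m , eq) })
    where
    relabel : ∀ (ζ : Comp n) x → lookup (swap ζ a b) (τ x) ≡ lookup ζ x + 0
    relabel ζ x = trans (lookup-swap-τ ζ x) (sym (+-identityʳ _))

  Glide-unswap : Glide (swap η a b) (τ k) γ → ¬ Tight (swap η a b) (τ k) γ → Glide η k (swap γ a b)
  Glide-unswap {η = η} {k = k} {γ = γ} g ¬tight =
    subst₂ (λ ζ x → Glide ζ x (swap γ a b)) (swap-involutive η) (τ-involutive k) (Glide-swap g ¬tight)

  Tight⇒gap : Tight η k δ → a ≡ k × lookup η b + 1 < lookup η a
  Tight⇒gap {η = η} (refl , l , m , eq) =
    refl , subst (lookup η b + 1 <_) eq
             (s≤s (subst (_≤ l + lookup η b) (+-comm 1 (lookup η b)) (m<n+m (lookup η b) (Move.0<l m))))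

  Tight-swap⇒gap : Tight (swap η a b) (τ k) γ → b ≡ k × lookup η a + 1 < lookup η b
  Tight-swap⇒gap {η = η} {k = k} t with a≡τk , gap ← Tight⇒gap t =
    trans (sym τa≡b) (trans (cong τ a≡τk) (τ-involutive k)) ,
    subst₂ (λ u v → u + 1 < v) (lookup-swap-b η) (lookup-swap-a η) gap

  Tight⇒swap≡star : Tight η k δ → swap δ a b ≡ star η k
  Tight⇒swap≡star {η = η} {δ = δ} (refl , l , m , eq) =
    vec-ext λ x → trans (lookup-swap δ x) (pointwise x)
    where
    open Move m
    open ≡-Reasoning
    pointwise : ∀ x → lookup δ (τ x) ≡ lookup (star η a) x
    pointwise x with place x
    ... | at-a refl = begin
      lookup δ (τ a)             ≡⟨ cong (lookup δ) τa≡b ⟩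
      lookup δ b                 ≡⟨ at-j ⟩
      lookup η b + l             ≡⟨ +-comm _ l ⟩
      pred (suc l + lookup η b)  ≡⟨ cong pred eq ⟩
      lookup η a ∸ 1             ≡⟨ lookup-star η a ⟨
      lookup (star η a) a        ∎
    ... | at-b refl = begin
      lookup δ (τ b)       ≡⟨ cong (lookup δ) τb≡a ⟩
      lookup δ a           ≡⟨ +-cancelˡ-≡ (suc l) _ _ (trans (sym (m+n+1≡1+n+m _ l)) (trans at-k (sym eq))) ⟩
      lookup η b           ≡⟨ lookup-star-≢ η a (a≢b ∘ sym) ⟨
      lookup (star η a) b  ∎
    ... | apart x≢a x≢b =
      trans (cong (lookup δ) (τ-fix x≢a x≢b)) (trans (elsewhere x x≢b x≢a) (sym (lookup-star-≢ η a x≢a)))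

  Glide-tight : lookup η b + 1 < lookup η a → Glide η a (swap (star η a) a b)
  Glide-tight {η = η} gap = glide {target = b} {amount = l₀} move headroom
    where
    open ≡-Reasoning
    gap′ = m+1<n⇒1+m<n gap
    l₀ = lookup η a ∸ suc (lookup η b)
    eq : suc l₀ + lookup η b ≡ lookup η a
    eq = trans (sym (+-suc l₀ (lookup η b))) (m∸n+n≡m (<⇒≤ gap′))
    move : Move η a (swap (star η a) a b) b l₀
    move = record
      { j≢k = a≢b ∘ sym
      ; 0<l = m<n⇒0<n∸m gap′
      ; at-j = begin
          lookup (swap (star η a) a b) b  ≡⟨ lookup-swap-b (star η a) ⟩
          lookup (star η a) a             ≡⟨ lookup-star η a ⟩
          lookup η a ∸ 1                  ≡⟨ cong pred eq ⟨
          l₀ + lookup η b                 ≡⟨ +-comm l₀ _ ⟩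
          lookup η b + l₀                 ∎
      ; at-k = begin
          lookup (swap (star η a) a b) a + l₀ + 1  ≡⟨ cong (λ x → x + l₀ + 1) (lookup-swap-a (star η a)) ⟩
          lookup (star η a) b + l₀ + 1             ≡⟨ cong (λ x → x + l₀ + 1) (lookup-star-≢ η a (a≢b ∘ sym)) ⟩
          lookup η b + l₀ + 1                      ≡⟨ m+n+1≡1+n+m _ l₀ ⟩
          suc l₀ + lookup η b                      ≡⟨ eq ⟩
          lookup η a                               ∎
      ; elsewhere = λ i i≢b i≢a →
          trans (lookup-swap (star η a) i)
            (trans (cong (lookup (star η a)) (τ-fix i≢a i≢b)) (lookup-star-≢ η a i≢a))
      }
    headroom : Headroom η a b (suc l₀)
    headroom = subst (λ x → x + (suc l₀ + lookup η b) ≤ lookup η a) (sym (⟦<⟧≡0 (<⇒≤ a<b))) (≤-reflexive eq)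

  star-excluded : lookup η b + 1 < lookup η a → ¬ Glide (swap η a b) b (star η a)
  star-excluded {η = η} gap (glide {j} {l} m h) with j ≟ᶠ a
  ... | yes refl =
    <-irrefl (+-comm l (lookup η b)) (subst (suc (l + lookup η b) ≤_) ηa-1≡ηb+l (pred-mono-≤ h′))
    where
    open Move m
    h′ : suc (suc l + lookup η b) ≤ lookup η a
    h′ = subst₂ _≤_ (cong₂ (λ u v → u + (suc l + v)) (⟦<⟧≡1 a<b) (lookup-swap-a η)) (lookup-swap-b η) h
    ηa-1≡ηb+l : lookup η a ∸ 1 ≡ lookup η b + l
    ηa-1≡ηb+l = trans (sym (lookup-star η a)) (trans at-j (cong (_+ l) (lookup-swap-a η)))
  ... | no j≢a = <⇒≢ (pred-mono-≤ (m+1<n⇒1+m<n gap))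
    (sym (trans (sym (lookup-star η a)) (trans (Move.elsewhere m a (j≢a ∘ sym) a≢b) (lookup-swap-a η))))

  P-swap : IsCritical η k → swap η a b ≢ η →
    ¬ (b ≡ k × lookup η a + 1 < lookup η b) → ¬ (a ≡ k × lookup η b + 1 < lookup η a) →
    P (swap η a b) ≐ image (λ δ → swap δ a b) (P η)
  P-swap {η = η} crit nontrivial no-gap-at-b no-gap-at-a γ = ⊆ , ⊇
    where
    crit′ = IsCritical-swap crit nontrivial
    ⊆ : P (swap η a b) γ → image (λ δ → swap δ a b) (P η) γ
    ⊆ p = swap γ a b ,
          from (P⇔Glide crit) (Glide-unswap (to (P⇔Glide crit′) p) (no-gap-at-b ∘ Tight-swap⇒gap)) ,
          swap-involutive γ
    ⊇ : image (λ δ → swap δ a b) (P η) γ → P (swap η a b) γ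
    ⊇ (δ , p , refl) = from (P⇔Glide crit′) (Glide-swap (to (P⇔Glide crit) p) (no-gap-at-a ∘ Tight⇒gap))

  P-swap-∪ : IsCritical η b → swap η a b ≢ η → lookup η a + 1 < lookup η b →
    P (swap η a b) ≐ (image (λ δ → swap δ a b) (P η) ∪ singleton (star η b))
  P-swap-∪ {η = η} crit nontrivial gap γ = ⊆ , ⊇
    where
    crit′ = IsCritical-swap crit nontrivial
    ⊆ : P (swap η a b) γ → (image (λ δ → swap δ a b) (P η) ∪ singleton (star η b)) γ
    ⊆ p with ≡-dec _≟ℕ_ γ (star η b)
    ... | yes γ≡star = inj₂ γ≡star
    ... | no γ≢star =
      inj₁ (swap γ a b , from (P⇔Glide crit) (Glide-unswap g (γ≢star ∘ tight⇒star)) , swap-involutive γ)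
      where
      g = to (P⇔Glide crit′) p
      tight⇒star : Tight (swap η a b) (τ b) γ → γ ≡ star η b
      tight⇒star t = trans (sym (swap-involutive γ))
                       (trans (cong (λ ζ → swap ζ a b) (Tight⇒swap≡star t)) (swap-star-swap η b))
    ⊇ : (image (λ δ → swap δ a b) (P η) ∪ singleton (star η b)) γ → P (swap η a b) γ
    ⊇ (inj₁ (δ , p , refl)) =
      from (P⇔Glide crit′) (Glide-swap (to (P⇔Glide crit) p) λ (b≡a , _) → a≢b (sym b≡a))
    ⊇ (inj₂ refl) =
      from (P⇔Glide crit′) (subst (Glide (swap η a b) (τ b)) (swap-star-swap η b)
        (subst (λ x → Glide (swap η a b) x (swap (star (swap η a b) x) a b)) (sym τb≡a)
          (Glide-tight (subst₂ (λ u v → u + 1 < v) (sym (lookup-swap-b η)) (sym (lookup-swap-a η)) gap))))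

  P-swap-∖ : IsCritical η a → swap η a b ≢ η → lookup η b + 1 < lookup η a →
    P (swap η a b) ≐ (image (λ δ → swap δ a b) (P η) ∖ singleton (star η a))
  P-swap-∖ {η = η} crit nontrivial gap γ = ⊆ , ⊇
    where
    crit′ = IsCritical-swap crit nontrivial
    ⊆ : P (swap η a b) γ → (image (λ δ → swap δ a b) (P η) ∖ singleton (star η a)) γ
    ⊆ p = (swap γ a b ,
           from (P⇔Glide crit) (Glide-unswap g λ (τa≡a , _) → a≢b (trans (sym τa≡a) τa≡b)) ,
           swap-involutive γ) ,
          λ { refl → star-excluded gap (subst (λ x → Glide (swap η a b) x (star η a)) τa≡b g) }
      where g = to (P⇔Glide crit′) p
    ⊇ : (image (λ δ → swap δ a b) (P η) ∖ singleton (star η a)) γ → P (swap η a b) γ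
    ⊇ ((δ , p , refl) , swapδ≢star) =
      from (P⇔Glide crit′) (Glide-swap (to (P⇔Glide crit) p) (swapδ≢star ∘ Tight⇒swap≡star))

-- The hypothesis NonzeroComp η only guarantees that a critical row exists, which is assumed anyway.
proposition4p7 : ∀ {n} (η : Comp n) (k : Fin n) → NonzeroComp η → IsCritical η k →
    (P (Φ η) ≐ image Φ (P η)) ×
    ((i j : Fin n) → toℕ j ≡ suc (toℕ i) → swap η i j ≢ η →
      ((¬ (j ≡ k × lookup η i + 1 < lookup η j)) →
       (¬ (i ≡ k × lookup η j + 1 < lookup η i)) →
       P (swap η i j) ≐ image (λ δ → swap δ i j) (P η)) ×
      ((j ≡ k) → lookup η i + 1 < lookup η j →
       P (swap η i j) ≐ (image (λ δ → swap δ i j) (P η) ∪ singleton (star η k))) ×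
      ((i ≡ k) → lookup η j + 1 < lookup η i →
       P (swap η i j) ≐ (image (λ δ → swap δ i j) (P η) ∖ singleton (star η k))))
proposition4p7 η k _ crit =
  P-Φ crit ,
  λ i j adjacent nontrivial →
    P-swap adjacent crit nontrivial ,
    (λ { refl gap → P-swap-∪ adjacent crit nontrivial gap }) ,
    (λ { refl gap → P-swap-∖ adjacent crit nontrivial gap })
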